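{- For every constant $K\ge1$ there is a constant $C$ such that for every $n$, the complete graph $G=K_n$ satisfies $\widetilde{\mathsf{EC}}(G)\le Cn^2$ for every choice of rotor sequence lengths with $\tilde\kappa\le K$.
   Context: Unweighted deterministic walk: each vertex $u$ has a rotor sequence of length $\tilde d(u)$ consisting of neighbours of $u$, each occurring exactly $\tilde d(u)/\deg(u)$ times, and an initial rotor position; $\tilde\kappa=\max_u\tilde d(u)/\deg(u)$. The walk moves from the current vertex to the vertex its rotor points at and then advances that rotor cyclically to the next entry. $\widetilde{\mathsf{EC}}(G)$ is the maximum over start vertices and all rotor sequences/initial positions (lengths fixed) of the first time at which every edge has been traversed. (The paper states its bounds for specific graphs under the standing assumption $\tilde\kappa=O(1)$.) -}

module Defs where

open import Data.Nat using (ℕ; zero; suc; _<_; _<?_)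
open import Data.Fin using (Fin; zero; suc; toℕ; fromℕ<; _≟_)
open import Data.List using (List; []; _∷_; length; lookup)
open import Data.Product using (Σ; ∃; _×_; _,_)
open import Data.Sum using (_⊎_)
open import Relation.Nullary using (yes; no; ¬_)
open import Relation.Binary.PropositionalEquality using (_≡_)

occ : ∀ {n} → Fin n → List (Fin n) → ℕ
occ v [] = 0
occ v (w ∷ ws) with v ≟ w
... | yes _ = suc (occ v ws)
... | no _  = occ v ws

cyc : ∀ {k} → Fin k → Fin k
cyc {suc k} i with suc (toℕ i) <? suc k
... | yes p = fromℕ< p
... | no _  = zero

-- Rotor walk on vertex set Fin n; σ u is the rotor sequence of u.
-- A state: current vertex and a rotor position for every vertex.
record State {n : ℕ} (σ : Fin n → List (Fin n)) : Set where
  constructor ⟨_,_⟩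
  field
    pos : Fin n
    rot : (u : Fin n) → Fin (length (σ u))
open State public

advanceAt : ∀ {n} {σ : Fin n → List (Fin n)} → Fin n →
            ((u : Fin n) → Fin (length (σ u))) → (u : Fin n) → Fin (length (σ u))
advanceAt x ρ v with v ≟ x
... | yes _ = cyc (ρ v)
... | no _  = ρ v

step : ∀ {n} {σ : Fin n → List (Fin n)} → State σ → State σ
step {σ = σ} ⟨ x , ρ ⟩ = ⟨ lookup (σ x) (ρ x) , advanceAt {σ = σ} x ρ ⟩

walk : ∀ {n} {σ : Fin n → List (Fin n)} → State σ → ℕ → State σ
walk s zero    = s
walk s (suc t) = step (walk s t)

Traversed : ∀ {n} {σ : Fin n → List (Fin n)} → State σ → Fin n → Fin n → ℕ → Set
Traversed s u v T = ∃ λ t → t < T ×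
  ((pos (walk s t) ≡ u × pos (walk s (suc t)) ≡ v) ⊎
   (pos (walk s t) ≡ v × pos (walk s (suc t)) ≡ u))

-- every edge of the complete graph K_n is traversed within the first T steps
-- (i.e. the edge cover time of the walk from s is at most T)
CoveredWithin : ∀ {n} {σ : Fin n → List (Fin n)} → State σ → ℕ → Set
CoveredWithin {n} s T = (u v : Fin n) → ¬ (u ≡ v) → Traversed s u v T

-- σ is a valid rotor-sequence assignment for K_n where vertex u has each
-- neighbour exactly m u times (so d̃(u) = m u * deg u, d̃(u)/deg(u) = m u)
ValidRotors : ∀ {n} → (Fin n → List (Fin n)) → (Fin n → ℕ) → Set
ValidRotors {n} σ m = (u : Fin n) → occ u (σ u) ≡ 0 ×
  ((v : Fin n) → ¬ (u ≡ v) → occ v (σ u) ≡ m u)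

module Submission where

-- Let every rotor sequence have length at most M and contain every other
-- vertex.  Write visits u T for the number of times t < T with the walk at u,
-- and traversals u v T for the number of steps u → v among the first T.
-- Since the rotor of u advances exactly once per visit, the exits from u are
-- read off its rotor sequence cyclically, so each block of M consecutive
-- visits to u contains a step u → v:  visits u T + 1 ≤ (traversals u v T + 1)·M.
-- Suppose some v had fewer than M visits.  The same bound then holds for
-- u = v trivially; summing over u, and using that the traversals into v
-- are the entries into v (at most visits v T + 1 ≤ M of them), gives
--     n + T ≤ (n + M)·M.
-- Hence for T = (n + M)·M every vertex is visited at least M times, so every
-- rotor has gone through its whole sequence and every edge is traversed.
-- For K_n with multiplicities at most K we take M = n·K, i.e. T = (K + K²)·n².

open import Defs
open import Data.Nat using (ℕ; zero; suc; _≤_; _<_; _*_; _+_; _∸_; z≤n; s≤s; _<?_; NonZero; >-nonZero)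
open import Data.Nat.Properties hiding (_≟_)
open import Data.Nat.DivMod using (_/_; _%_; m≡m%n+[m/n]*n; m%n<n; m/n*n≤m)
open import Data.Nat.GeneralisedArithmetic using (fold; fold-+)
open import Data.Nat.Tactic.RingSolver using (solve-∀)
open import Algebra.Properties.Semiring.Sum +-*-semiring using (sum; sum-cong-≗; ∑-distrib-+; *-distribʳ-sum)
open import Algebra.Properties.CommutativeSemigroup +-commutativeSemigroup using (xy∙z≈xz∙y)
open import Data.Fin using (Fin; zero; suc; toℕ; _≟_)
open import Data.Fin.Properties using (toℕ-fromℕ<; toℕ-injective; toℕ<n)
open import Data.List using (List; []; _∷_; length; lookup)
open import Data.Product using (∃; _,_; proj₁; proj₂)
open import Data.Sum using (inj₁)
open import Data.Empty using (⊥-elim)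
open import Function using (_∘_)
open import Relation.Nullary using (yes; no; ¬_)
open import Relation.Binary.PropositionalEquality

δ : ∀ {n} → Fin n → Fin n → ℕ
δ a b with a ≟ b
... | yes _ = 1
... | no _  = 0

δ-refl : ∀ {n} (a : Fin n) → δ a a ≡ 1
δ-refl a with a ≟ a
... | yes _   = refl
... | no a≢a = ⊥-elim (a≢a refl)

δ-≢ : ∀ {n} (a b : Fin n) → ¬ a ≡ b → δ a b ≡ 0
δ-≢ a b a≢b with a ≟ b
... | yes a≡b = ⊥-elim (a≢b a≡b)
... | no _    = refl

δ-suc : ∀ {n} (a b : Fin n) → δ (suc a) (suc b) ≡ δ a b
δ-suc a b with a ≟ b
... | yes _ = refl
... | no _  = refl

δ≤1 : ∀ {n} (a b : Fin n) → δ a b ≤ 1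
δ≤1 a b with a ≟ b
... | yes _ = s≤s z≤n
... | no _  = z≤n

sum-mono-≤ : ∀ {n} {f g : Fin n → ℕ} → (∀ u → f u ≤ g u) → sum f ≤ sum g
sum-mono-≤ {zero}  f≤g = z≤n
sum-mono-≤ {suc n} f≤g = +-mono-≤ (f≤g zero) (sum-mono-≤ (f≤g ∘ suc))

sum-const : ∀ n c → sum {n} (λ _ → c) ≡ n * c
sum-const zero    c = refl
sum-const (suc n) c = cong (c +_) (sum-const n c)

sum-zero : ∀ n → sum {n} (λ _ → 0) ≡ 0
sum-zero n = trans (sum-const n 0) (*-zeroʳ n)

sum-δ : ∀ {n} (w : Fin n) → sum (λ u → δ u w) ≡ 1
sum-δ {suc n} zero = cong₂ _+_ (δ-refl {suc n} zero)
  (trans (sum-cong-≗ {n} (λ u → δ-≢ (suc u) zero λ ())) (sum-zero n))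
sum-δ {suc n} (suc w) = cong₂ _+_ (δ-≢ zero (suc w) λ ())
  (trans (sum-cong-≗ (λ u → δ-suc u w)) (sum-δ w))

occ-∷ : ∀ {n} (v w : Fin n) ws → occ v (w ∷ ws) ≡ δ v w + occ v ws
occ-∷ v w ws with v ≟ w
... | yes _ = refl
... | no _  = refl

length≡sum-occ : ∀ {n} (l : List (Fin n)) → length l ≡ sum (λ v → occ v l)
length≡sum-occ {n} [] = sym (sum-zero n)
length≡sum-occ (w ∷ ws) = sym (begin
    sum (λ v → occ v (w ∷ ws))
  ≡⟨ sum-cong-≗ (λ v → occ-∷ v w ws) ⟩
    sum (λ v → δ v w + occ v ws)
  ≡⟨ ∑-distrib-+ (λ v → δ v w) (λ v → occ v ws) ⟩
    sum (λ v → δ v w) + sum (λ v → occ v ws)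
  ≡⟨ cong₂ _+_ (sum-δ w) (sym (length≡sum-occ ws)) ⟩
    suc (length ws) ∎)
  where open ≡-Reasoning

occ⇒lookup : ∀ {n} (v : Fin n) l → 1 ≤ occ v l → ∃ λ p → lookup l p ≡ v
occ⇒lookup v (w ∷ ws) h with v ≟ w
... | yes v≡w = zero , sym v≡w
... | no _ with occ⇒lookup v ws h
...   | p , e = suc p , e

rotate : ∀ {L} → ℕ → Fin L → Fin L
rotate j x = fold x cyc j

rotate-+ : ∀ {L} i j (x : Fin L) → rotate (i + j) x ≡ rotate i (rotate j x)
rotate-+ i j x = fold-+ x cyc i

toℕ-cyc : ∀ {k} (i : Fin (suc k)) → suc (toℕ i) < suc k → toℕ (cyc i) ≡ suc (toℕ i)
toℕ-cyc {k} i lt with suc (toℕ i) <? suc k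
... | yes p  = toℕ-fromℕ< p
... | no ¬lt = ⊥-elim (¬lt lt)

cyc-last : ∀ {k} (i : Fin (suc k)) → toℕ i ≡ k → cyc i ≡ zero
cyc-last {k} i i≡k with suc (toℕ i) <? suc k
... | yes p = ⊥-elim (<-irrefl refl (subst (λ z → suc z < suc k) i≡k p))
... | no _  = refl

toℕ-rotate-zero : ∀ {k} j → j < suc k → toℕ (rotate j (zero {k})) ≡ j
toℕ-rotate-zero zero    _  = refl
toℕ-rotate-zero {k} (suc j) lt =
  trans (toℕ-cyc (rotate j zero) (subst (λ z → suc z < suc k) (sym ih) lt)) (cong suc ih)
  where ih = toℕ-rotate-zero j (<-trans (n<1+n j) lt)

rotate-toℕ : ∀ {k} (x : Fin (suc k)) → rotate (toℕ x) zero ≡ x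
rotate-toℕ x = toℕ-injective (toℕ-rotate-zero (toℕ x) (toℕ<n x))

rotate-period : ∀ {k} → rotate (suc k) (zero {k}) ≡ zero
rotate-period {k} = cyc-last (rotate k zero) (toℕ-rotate-zero k (n<1+n k))

hits : ∀ {n L} → (Fin L → Fin n) → Fin n → Fin L → ℕ → ℕ
hits f v x zero    = 0
hits f v x (suc a) = hits f v x a + δ v (f (rotate a x))

module Hits {n k : ℕ} (f : Fin (suc k) → Fin n) (v : Fin n) where
  L : ℕ
  L = suc k

  hits-+ : ∀ x b a → hits f v x (b + a) ≡ hits f v x a + hits f v (rotate a x) b
  hits-+ x zero    a = sym (+-identityʳ _)
  hits-+ x (suc b) a =
    trans (cong₂ _+_ (hits-+ x b a) (cong (λ z → δ v (f z)) (rotate-+ b a x)))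
          (+-assoc (hits f v x a) _ _)

  hits-mono : ∀ x {a a′} → a ≤ a′ → hits f v x a ≤ hits f v x a′
  hits-mono x {a} {a′} a≤a′ = subst (λ z → hits f v x a ≤ hits f v x z) (m∸n+n≡m a≤a′)
    (subst (hits f v x a ≤_) (sym (hits-+ x (a′ ∸ a) a)) (m≤m+n _ _))

  hits-period : ∀ x → hits f v x L ≡ hits f v zero L
  hits-period x = trans (cong (λ z → hits f v z L) (sym (rotate-toℕ x)))
    (+-cancelˡ-≡ (hits f v zero a) _ _ (begin
      hits f v zero a + hits f v (rotate a zero) L
    ≡⟨ sym (hits-+ zero L a) ⟩
      hits f v zero (L + a)
    ≡⟨ cong (hits f v zero) (+-comm L a) ⟩
      hits f v zero (a + L)
    ≡⟨ hits-+ zero a L ⟩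
      hits f v zero L + hits f v (rotate L zero) a
    ≡⟨ cong (λ z → hits f v zero L + hits f v z a) rotate-period ⟩
      hits f v zero L + hits f v zero a
    ≡⟨ +-comm (hits f v zero L) _ ⟩
      hits f v zero a + hits f v zero L ∎))
    where open ≡-Reasoning
          a = toℕ x

  hits-period-pos : ∀ p → f p ≡ v → ∀ x → 1 ≤ hits f v x L
  hits-period-pos p fp≡v x = begin
      1
    ≡⟨ sym (δ-refl v) ⟩
      δ v v
    ≡⟨ cong (δ v) (sym fp≡v) ⟩
      δ v (f p)
    ≡⟨ cong (λ z → δ v (f z)) (sym (rotate-toℕ p)) ⟩
      δ v (f (rotate (toℕ p) zero))
    ≤⟨ m≤n+m _ _ ⟩
      hits f v zero (suc (toℕ p))
    ≤⟨ hits-mono zero (toℕ<n p) ⟩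
      hits f v zero L
    ≡⟨ sym (hits-period x) ⟩
      hits f v x L ∎
    where open ≤-Reasoning

  hits-periods : ∀ p → f p ≡ v → ∀ j x → j ≤ hits f v x (j * L)
  hits-periods p fp≡v zero    x = z≤n
  hits-periods p fp≡v (suc j) x = begin
      suc j
    ≡⟨ +-comm 1 j ⟩
      j + 1
    ≤⟨ +-mono-≤ (hits-periods p fp≡v j x) (hits-period-pos p fp≡v (rotate (j * L) x)) ⟩
      hits f v x (j * L) + hits f v (rotate (j * L) x) L
    ≡⟨ sym (hits-+ x L (j * L)) ⟩
      hits f v x (suc j * L) ∎
    where open ≤-Reasoning

hits-lower : ∀ {n L} (f : Fin L → Fin n) v (x p : Fin L) → f p ≡ v →
             ∀ j a → j * L ≤ a → j ≤ hits f v x a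
hits-lower {L = suc k} f v x p fp≡v j a j*L≤a =
  ≤-trans (Hits.hits-periods f v p fp≡v j x) (Hits.hits-mono f v x j*L≤a)

-- Taking j = ⌊a/M⌋: if every j with j·M ≤ a satisfies j ≤ t, then a < (t+1)·M.
floor-bound : ∀ a M t .{{_ : NonZero M}} → (∀ j → j * M ≤ a → j ≤ t) → suc a ≤ suc t * M
floor-bound a M t bound = begin
    suc a
  ≡⟨ cong suc (m≡m%n+[m/n]*n a M) ⟩
    suc (a % M + a / M * M)
  ≤⟨ +-monoˡ-≤ (a / M * M) (m%n<n a M) ⟩
    suc (a / M) * M
  ≤⟨ *-monoˡ-≤ M (s≤s (bound (a / M) (m/n*n≤m a M))) ⟩
    suc t * M ∎
  where open ≤-Reasoning

module Walk {n : ℕ} {σ : Fin n → List (Fin n)} (s : State σ) where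
  at : ℕ → Fin n
  at t = pos (walk s t)

  visits : Fin n → ℕ → ℕ
  visits u zero    = 0
  visits u (suc t) = visits u t + δ u (at t)

  traversals : Fin n → Fin n → ℕ → ℕ
  traversals u v zero    = 0
  traversals u v (suc t) = traversals u v t + δ u (at t) * δ v (at (suc t))

  entries : Fin n → ℕ → ℕ
  entries v zero    = 0
  entries v (suc t) = entries v t + δ v (at (suc t))

  sum-visits : ∀ t → sum (λ u → visits u t) ≡ t
  sum-visits zero    = sum-zero n
  sum-visits (suc t) = trans (∑-distrib-+ (λ u → visits u t) (λ u → δ u (at t)))
    (trans (cong₂ _+_ (sum-visits t) (sum-δ (at t))) (+-comm t 1))

  sum-traversals : ∀ v t → sum (λ u → traversals u v t) ≡ entries v t
  sum-traversals v zero    = sum-zero n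
  sum-traversals v (suc t) = trans (∑-distrib-+ (λ u → traversals u v t) _)
    (cong₂ _+_ (sum-traversals v t) (begin
      sum (λ u → δ u (at t) * δ v (at (suc t)))
    ≡⟨ sym (*-distribʳ-sum (δ v (at (suc t))) (λ u → δ u (at t))) ⟩
      sum (λ u → δ u (at t)) * δ v (at (suc t))
    ≡⟨ cong (_* δ v (at (suc t))) (sum-δ (at t)) ⟩
      1 * δ v (at (suc t))
    ≡⟨ *-identityˡ _ ⟩
      δ v (at (suc t)) ∎))
    where open ≡-Reasoning

  -- Entries count times 1..t, visits count times 0..t-1.
  entries-shift : ∀ v t → entries v t + δ v (at 0) ≡ visits v t + δ v (at t)
  entries-shift v zero    = refl
  entries-shift v (suc t) =
    trans (xy∙z≈xz∙y (entries v t) _ _) (cong (_+ δ v (at (suc t))) (entries-shift v t))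

  entries-bound : ∀ v t → entries v t ≤ suc (visits v t)
  entries-bound v t = begin
      entries v t
    ≤⟨ m≤m+n _ _ ⟩
      entries v t + δ v (at 0)
    ≡⟨ entries-shift v t ⟩
      visits v t + δ v (at t)
    ≤⟨ +-monoʳ-≤ (visits v t) (δ≤1 v (at t)) ⟩
      visits v t + 1
    ≡⟨ +-comm (visits v t) 1 ⟩
      suc (visits v t) ∎
    where open ≤-Reasoning

  rotor-after : ∀ u t → rot (walk s t) u ≡ rotate (visits u t) (rot s u)
  rotor-after u zero = refl
  rotor-after u (suc t) with u ≟ at t
  ... | yes _ = trans (cong cyc (rotor-after u t))
                      (cong (λ j → rotate j (rot s u)) (+-comm 1 (visits u t)))
  ... | no _  = trans (rotor-after u t)
                      (cong (λ j → rotate j (rot s u)) (sym (+-identityʳ (visits u t))))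

  step-from : ∀ u (w : State σ) → u ≡ pos w → pos (step w) ≡ lookup (σ u) (rot w u)
  step-from u ⟨ x , ρ ⟩ refl = refl

  traversals≡hits : ∀ u v t → traversals u v t ≡ hits (lookup (σ u)) v (rot s u) (visits u t)
  traversals≡hits u v zero = refl
  traversals≡hits u v (suc t) with u ≟ at t
  ... | yes u≡at = begin
      traversals u v t + (δ v (at (suc t)) + 0)
    ≡⟨ cong₂ _+_ (traversals≡hits u v t) (+-identityʳ _) ⟩
      hits H v r (visits u t) + δ v (at (suc t))
    ≡⟨ cong (λ w → hits H v r (visits u t) + δ v w) exit ⟩
      hits H v r (visits u t) + δ v (H (rotate (visits u t) r))
    ≡⟨ cong (hits H v r) (+-comm 1 (visits u t)) ⟩
      hits H v r (visits u t + 1) ∎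
    where
    open ≡-Reasoning
    H = lookup (σ u)
    r = rot s u
    exit : at (suc t) ≡ H (rotate (visits u t) r)
    exit = trans (step-from u (walk s t) u≡at) (cong H (rotor-after u t))
  ... | no _ = trans (+-identityʳ _) (trans (traversals≡hits u v t)
      (cong (hits (lookup (σ u)) v (rot s u)) (sym (+-identityʳ (visits u t)))))

  traversed-later : ∀ {u v T} → Traversed s u v T → Traversed s u v (suc T)
  traversed-later (t , t<T , edge) = t , m<n⇒m<1+n t<T , edge

  traversed : ∀ u v T → 1 ≤ traversals u v T → Traversed s u v T
  traversed u v (suc T) h with u ≟ at T | v ≟ at (suc T)
  ... | yes u≡at | yes v≡at = T , ≤-refl , inj₁ (sym u≡at , sym v≡at)
  ... | yes _    | no _     = traversed-later (traversed u v T (subst (1 ≤_) (+-identityʳ _) h))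
  ... | no _     | _        = traversed-later (traversed u v T (subst (1 ≤_) (+-identityʳ _) h))

AllNeighbours : ∀ {n} → (Fin n → List (Fin n)) → Set
AllNeighbours {n} σ = (u v : Fin n) → ¬ u ≡ v → ∃ λ p → lookup (σ u) p ≡ v

module Saturation {n : ℕ} {σ : Fin n → List (Fin n)} (s : State σ) (M : ℕ)
                  (short : ∀ u → length (σ u) ≤ M) (neighbours : AllNeighbours σ) where
  open Walk s

  traversals-lower : ∀ u v → ¬ u ≡ v → ∀ T j → j * M ≤ visits u T → j ≤ traversals u v T
  traversals-lower u v u≢v T j j*M≤visits = subst (j ≤_) (sym (traversals≡hits u v T))
    (hits-lower (lookup (σ u)) v (rot s u) (proj₁ (neighbours u v u≢v)) (proj₂ (neighbours u v u≢v))
                j (visits u T) (≤-trans (*-monoʳ-≤ j (short u)) j*M≤visits))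

  visits-bound : ∀ v T → visits v T < M → ∀ u → suc (visits u T) ≤ suc (traversals u v T) * M
  visits-bound v T v<M u with u ≟ v
  ... | yes refl = ≤-trans v<M (m≤m+n M _)
  ... | no u≢v   = floor-bound (visits u T) M (traversals u v T) {{>-nonZero (≤-<-trans z≤n v<M)}}
                               (traversals-lower u v u≢v T)

  counting : ∀ v T → visits v T < M → n + T ≤ (n + M) * M
  counting v T v<M = begin
      n + T
    ≡⟨ cong₂ _+_ (sym ones) (sym (sum-visits T)) ⟩
      sum {n} (λ _ → 1) + sum (λ u → visits u T)
    ≡⟨ sym (∑-distrib-+ {n} (λ _ → 1) (λ u → visits u T)) ⟩
      sum (λ u → suc (visits u T))
    ≤⟨ sum-mono-≤ (visits-bound v T v<M) ⟩
      sum (λ u → suc (traversals u v T) * M)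
    ≡⟨ sym (*-distribʳ-sum M (λ u → suc (traversals u v T))) ⟩
      sum (λ u → suc (traversals u v T)) * M
    ≡⟨ cong (_* M) (trans (∑-distrib-+ (λ _ → 1) (λ u → traversals u v T))
                          (cong₂ _+_ ones (sum-traversals v T))) ⟩
      (n + entries v T) * M
    ≤⟨ *-monoˡ-≤ M (+-monoʳ-≤ n (≤-trans (entries-bound v T) v<M)) ⟩
      (n + M) * M ∎
    where open ≤-Reasoning
          ones : sum {n} (λ _ → 1) ≡ n
          ones = trans (sum-const n 1) (*-identityʳ n)

  saturated : ∀ T → (n + M) * M ≤ T → ∀ v → M ≤ visits v T
  saturated T bound v with visits v T <? M
  ... | no ¬v<M = ≮⇒≥ ¬v<M
  ... | yes v<M = ⊥-elim (<⇒≱ (m<n+m T (≤-<-trans z≤n (toℕ<n v))) (≤-trans (counting v T v<M) bound))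

  cover-time : ∀ T → (n + M) * M ≤ T → CoveredWithin s T
  cover-time T bound u v u≢v = traversed u v T (traversals-lower u v u≢v T 1
    (≤-trans (≤-reflexive (*-identityˡ M)) (saturated T bound u)))

valid-length : ∀ {n} {σ : Fin n → List (Fin n)} {m : Fin n → ℕ} K →
               ValidRotors σ m → (∀ u → m u ≤ K) → ∀ u → length (σ u) ≤ n * K
valid-length {n} {σ} {m} K valid m≤K u = begin
    length (σ u)
  ≡⟨ length≡sum-occ (σ u) ⟩
    sum (λ v → occ v (σ u))
  ≤⟨ sum-mono-≤ occ≤K ⟩
    sum {n} (λ _ → K)
  ≡⟨ sum-const n K ⟩
    n * K ∎
  where
  open ≤-Reasoning
  occ≤K : ∀ v → occ v (σ u) ≤ K
  occ≤K v with u ≟ v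
  ... | yes refl = subst (_≤ K) (sym (proj₁ (valid u))) z≤n
  ... | no u≢v   = subst (_≤ K) (sym (proj₂ (valid u) v u≢v)) (m≤K u)

multiplicity-pos : ∀ {n} (u : Fin n) l m → Fin (length l) → occ u l ≡ 0 →
                   (∀ v → ¬ u ≡ v → occ v l ≡ m) → 1 ≤ m
multiplicity-pos u (w ∷ ws) m _ no-u each with u ≟ w
... | yes _  = ⊥-elim (1+n≢0 no-u)
... | no u≢w = begin
    1
  ≡⟨ sym (δ-refl w) ⟩
    δ w w
  ≤⟨ m≤m+n _ _ ⟩
    δ w w + occ w ws
  ≡⟨ sym (occ-∷ w w ws) ⟩
    occ w (w ∷ ws)
  ≡⟨ each w u≢w ⟩
    m ∎
  where open ≤-Reasoning

-- Valid rotor sequences admitting a state (so all are nonempty) contain all neighbours.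
valid-neighbours : ∀ {n} {σ : Fin n → List (Fin n)} {m : Fin n → ℕ} →
                   ValidRotors σ m → State σ → AllNeighbours σ
valid-neighbours {σ = σ} {m} valid s u v u≢v = occ⇒lookup v (σ u)
  (subst (1 ≤_) (sym (proj₂ (valid u) v u≢v))
    (multiplicity-pos u (σ u) (m u) (rot s u) (proj₁ (valid u)) (proj₂ (valid u))))

-- (n + M)·M for M = n·K is the claimed bound (K + K²)·n².
time-identity : ∀ n K → (n + n * K) * (n * K) ≡ (K + K * K) * (n * n)
time-identity = solve-∀

-- Theorem 3.14: C = K + K² works (the bound holds even without 1 ≤ K).
theorem3p14 : (K : ℕ) → 1 ≤ K → ∃ λ (C : ℕ) → (n : ℕ) →
    (σ : Fin n → List (Fin n)) → (m : Fin n → ℕ) → ValidRotors σ m →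
    ((u : Fin n) → m u ≤ K) →
    (s : State σ) → CoveredWithin s (C * (n * n))
theorem3p14 K _ = K + K * K , λ n σ m valid m≤K s →
  Saturation.cover-time s (n * K) (valid-length {σ = σ} K valid m≤K) (valid-neighbours valid s)
    ((K + K * K) * (n * n)) (≤-reflexive (time-identity n K))
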